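{- Let $\mathsf V$ be a variety such that every finite direct product of 1-generated exact algebras of $\mathsf V$ is finitely generated and projective in $\mathsf V$. Then $\mathsf V$ has unitary e-generalization type (indeed unitary $\kappa$-type for every cardinal $\kappa\le\omega$).
   Context: Projective in $\mathsf V$ = retract of a free algebra of $\mathsf V$; exact = isomorphic to a finitely generated subalgebra of a finitely generated free algebra. An algebraic e-generalization problem is a homomorphism $h:\mathbf F_{\mathsf V}(z)\to\prod_{k=1}^m\mathbf E_k$ ($m\ge1$, $\mathbf F_{\mathsf V}(z)$ the 1-generated free algebra), each $\mathbf E_k$ 1-generated exact, each $p_k\circ h$ surjective; a solution is a homomorphism $g:\mathbf F_{\mathsf V}(z)\to\mathbf P$ with $\mathbf P$ finitely generated projective and $f\circ g=h$ for some homomorphism $f$; $g\sqsubseteq g'$ iff $f\circ g'=g$ for some homomorphism $f$. A problem has unitary type if its poset of solutions (modulo equal generality) has a minimal complete set of cardinality 1 (a minimal complete set being a set of pairwise incomparable elements such that every element lies above one of them); types finitary/infinitary/nullary similarly. The $\kappa$-type of $\mathsf V$ is the worst type among problems with $m\le\kappa$ (order unitary $>$ finitary $>$ infinitary $>$ nullary); the e-generalization type is the $\omega$-type. (By the paper's results this coincides with the symbolic e-generalization type for the equational theory of $\mathsf V$.) -}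

module Defs where

open import Data.Nat using (ℕ; _≤_)
open import Data.Fin using (Fin)
open import Data.Product using (Σ; ∃; _×_; _,_)
open import Relation.Binary using (IsEquivalence)
open import Function using (_∘_)

record Signature : Set₁ where
  field
    Op    : Set
    arity : Op → ℕ
open Signature public

data Term (S : Signature) (X : Set) : Set where
  var : X → Term S X
  op  : (o : Op S) → (Fin (arity S o) → Term S X) → Term S X

subst : {S : Signature} {X Y : Set} → (X → Term S Y) → Term S X → Term S Y
subst σ (var x)   = σ x
subst σ (op o ts) = op o (λ k → subst σ (ts k))

record Algebra (S : Signature) : Set₁ where
  field
    Carrier : Set
    _≈_     : Carrier → Carrier → Set
    isEq    : IsEquivalence _≈_
    ⟦_⟧     : (o : Op S) → (Fin (arity S o) → Carrier) → Carrier
    ⟦⟧-cong : ∀ o {xs ys} → (∀ k → xs k ≈ ys k) → ⟦ o ⟧ xs ≈ ⟦ o ⟧ ys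
  open IsEquivalence isEq public renaming (refl to ≈-refl; sym to ≈-sym; trans to ≈-trans)
open Algebra public

eval : {S : Signature} {X : Set} (A : Algebra S) → (X → Carrier A) → Term S X → Carrier A
eval A ρ (var x)   = ρ x
eval A ρ (op o ts) = ⟦ A ⟧ o (λ k → eval A ρ (ts k))

-- Varieties, given (Birkhoff) by a set of identities over variables ℕ

record Equations (S : Signature) : Set₁ where
  field
    Idx : Set
    lhs : Idx → Term S ℕ
    rhs : Idx → Term S ℕ
open Equations public

_∈V_ : {S : Signature} → Algebra S → Equations S → Set
_∈V_ A E = ∀ i (ρ : ℕ → Carrier A) → _≈_ A (eval A ρ (lhs E i)) (eval A ρ (rhs E i))

data Deriv {S : Signature} (E : Equations S) {X : Set} : Term S X → Term S X → Set where
  d-refl  : ∀ {t} → Deriv E t t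
  d-sym   : ∀ {t u} → Deriv E t u → Deriv E u t
  d-trans : ∀ {t u v} → Deriv E t u → Deriv E u v → Deriv E t v
  d-cong  : ∀ o {ts us} → (∀ k → Deriv E (ts k) (us k)) → Deriv E (op o ts) (op o us)
  d-ax    : ∀ i (σ : ℕ → Term S X) → Deriv E (subst σ (lhs E i)) (subst σ (rhs E i))

FreeOn : {S : Signature} → Equations S → Set → Algebra S
FreeOn {S} E X = record
  { Carrier = Term S X
  ; _≈_     = Deriv E
  ; isEq    = record { refl = d-refl ; sym = d-sym ; trans = d-trans }
  ; ⟦_⟧     = op
  ; ⟦⟧-cong = d-cong
  }

Free : {S : Signature} → Equations S → ℕ → Algebra S
Free E n = FreeOn E (Fin n)

record Hom {S : Signature} (A B : Algebra S) : Set where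
  field
    fun     : Carrier A → Carrier B
    fun-cong : ∀ {x y} → _≈_ A x y → _≈_ B (fun x) (fun y)
    fun-op  : ∀ o (xs : Fin (arity S o) → Carrier A) →
              _≈_ B (fun (⟦ A ⟧ o xs)) (⟦ B ⟧ o (fun ∘ xs))
open Hom public

_∘H_ : {S : Signature} {A B C : Algebra S} → Hom B C → Hom A B → Hom A C
_∘H_ {C = C} g f = record
  { fun = fun g ∘ fun f
  ; fun-cong = fun-cong g ∘ fun-cong f
  ; fun-op = λ o xs → ≈-trans C (fun-cong g (fun-op f o xs)) (fun-op g o (fun f ∘ xs))
  }

idH : {S : Signature} {A : Algebra S} → Hom A A
idH {A = A} = record { fun = λ x → x ; fun-cong = λ p → p ; fun-op = λ o xs → ≈-refl A }

_≈H_ : {S : Signature} {A B : Algebra S} → Hom A B → Hom A B → Set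
_≈H_ {A = A} {B} f g = ∀ x → _≈_ B (fun f x) (fun g x)

GeneratedBy : {S : Signature} (A : Algebra S) {n : ℕ} → (Fin n → Carrier A) → Set
GeneratedBy A a = ∀ x → ∃ λ t → _≈_ A x (eval A a t)

FinGen : {S : Signature} → Algebra S → Set
FinGen A = ∃ λ n → Σ (Fin n → Carrier A) (GeneratedBy A)

OneGen : {S : Signature} → Algebra S → Set
OneGen A = Σ (Fin 1 → Carrier A) (GeneratedBy A)

Projective : {S : Signature} → Equations S → Algebra S → Set₁
Projective E P = Σ Set λ X → Σ (Hom (FreeOn E X) P) λ r → Σ (Hom P (FreeOn E X)) λ s →
  (r ∘H s) ≈H idH

-- exact: isomorphic to a finitely generated subalgebra of a finitely
-- generated free algebra, i.e. A is finitely generated and embeds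
-- (injective homomorphism, onto its image subalgebra) into some F_V(n)
Exact : {S : Signature} → Equations S → Algebra S → Set
Exact E A = FinGen A × ∃ λ n → Σ (Hom A (Free E n)) λ e →
  ∀ x y → _≈_ (Free E n) (fun e x) (fun e y) → _≈_ A x y

Π : {S : Signature} {m : ℕ} → (Fin m → Algebra S) → Algebra S
Π {S} {m} Es = record
  { Carrier = (k : Fin m) → Carrier (Es k)
  ; _≈_     = λ x y → ∀ k → _≈_ (Es k) (x k) (y k)
  ; isEq    = record { refl = λ k → ≈-refl (Es k)
                     ; sym = λ p k → ≈-sym (Es k) (p k)
                     ; trans = λ p q k → ≈-trans (Es k) (p k) (q k) }
  ; ⟦_⟧     = λ o xs k → ⟦ Es k ⟧ o (λ j → xs j k)
  ; ⟦⟧-cong = λ o p k → ⟦⟧-cong (Es k) o (λ j → p j k)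
  }

proj : {S : Signature} {m : ℕ} (Es : Fin m → Algebra S) (k : Fin m) → Hom (Π Es) (Es k)
proj Es k = record { fun = λ x → x k ; fun-cong = λ p → p k ; fun-op = λ o xs → ≈-refl (Es k) }

Surjective : {S : Signature} {A B : Algebra S} → Hom A B → Set
Surjective {B = B} f = ∀ y → ∃ λ x → _≈_ B (fun f x) y

record Problem {S : Signature} (E : Equations S) : Set₁ where
  field
    m      : ℕ
    m≥1    : 1 ≤ m
    Es     : Fin m → Algebra S
    Es∈V   : ∀ k → Es k ∈V E
    Es-1g  : ∀ k → OneGen (Es k)
    Es-ex  : ∀ k → Exact E (Es k)
    h      : Hom (Free E 1) (Π Es)
    h-surj : ∀ k → Surjective (proj Es k ∘H h)
open Problem public

record Solution {S : Signature} {E : Equations S} (p : Problem E) : Set₁ where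
  field
    P      : Algebra S
    P∈V    : P ∈V E
    P-fg   : FinGen P
    P-proj : Projective E P
    g      : Hom (Free E 1) P
    f      : Hom P (Π (Es p))
    f∘g≈h  : (f ∘H g) ≈H h p
open Solution public

_⊑_ : {S : Signature} {E : Equations S} {p : Problem E} → Solution p → Solution p → Set
s ⊑ s' = Σ (Hom (P s') (P s)) λ f → (f ∘H g s') ≈H g s

_≡g_ : {S : Signature} {E : Equations S} {p : Problem E} → Solution p → Solution p → Set
s ≡g s' = (s ⊑ s') × (s' ⊑ s)

IsMinimalComplete : {S : Signature} {E : Equations S} {p : Problem E} → (Solution p → Set) → Set₁
IsMinimalComplete {p = p} M =
  (∀ a b → M a → M b → a ⊑ b → a ≡g b) ×
  (∀ (t : Solution p) → ∃ λ a → M a × (a ⊑ t))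

-- unitary type: a minimal complete set of cardinality 1 (modulo ≡g)
Unitary : {S : Signature} {E : Equations S} → Problem E → Set₁
Unitary p = Σ (Solution p → Set) λ M → IsMinimalComplete M ×
  (∃ λ s → M s × (∀ a → M a → a ≡g s))

-- unitary e-generalization type (= ω-type): every problem (any finite m ≥ 1) is unitary
UnitaryEGenType : {S : Signature} → Equations S → Set₁
UnitaryEGenType E = ∀ (p : Problem E) → Unitary p

-- The homomorphism h of a problem is itself a solution: its codomain, a finite product of
-- 1-generated exact algebras, is finitely generated and projective by hypothesis (and lies in
-- V since varieties are closed under products), with f = id. Every solution (g, f) satisfies
-- f ∘ g = h, so h lies below every solution; the class of h is then a one-element minimal
-- complete set.
module Submission where

open import Defs
open import Data.Nat using (ℕ; _≤_)
open import Data.Fin using (Fin)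
open import Data.Product using (∃; _×_; _,_)

module _ {S : Signature} {m : ℕ} (Es : Fin m → Algebra S) where

  eval-Π : (ρ : ℕ → Carrier (Π Es)) (t : Term S ℕ) (k : Fin m) →
           _≈_ (Es k) (eval (Π Es) ρ t k) (eval (Es k) (λ n → ρ n k) t)
  eval-Π ρ (var x)   k = ≈-refl (Es k)
  eval-Π ρ (op o ts) k = ⟦⟧-cong (Es k) o (λ j → eval-Π ρ (ts j) k)

  Π-∈V : (E : Equations S) → (∀ k → Es k ∈V E) → Π Es ∈V E
  Π-∈V E Es∈V i ρ k =
    ≈-trans (Es k) (eval-Π ρ (lhs E i) k)
      (≈-trans (Es k) (Es∈V k i (λ n → ρ n k)) (≈-sym (Es k) (eval-Π ρ (rhs E i) k)))

module _ {S : Signature} {E : Equations S} {p : Problem E} where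

  ⊑-trans : (a b c : Solution p) → a ⊑ b → b ⊑ c → a ⊑ c
  ⊑-trans a _ _ (f , f∘g≈g) (f′ , f′∘g≈g) =
    f ∘H f′ , λ x → ≈-trans (P a) (fun-cong f (f′∘g≈g x)) (f∘g≈g x)

  least⇒unitary : (s : Solution p) → (∀ t → s ⊑ t) → Unitary p
  least⇒unitary s s⊑ = M , (minimal , complete) , s , s≡s , (λ a Ma → Ma)
    where
      M : Solution p → Set
      M a = a ≡g s

      s≡s : s ≡g s
      s≡s = s⊑ s , s⊑ s

      minimal : ∀ a b → M a → M b → a ⊑ b → a ≡g b
      minimal a b _ (b⊑s , _) a⊑b = a⊑b , ⊑-trans b s a b⊑s (s⊑ a)

      complete : ∀ t → ∃ λ a → M a × (a ⊑ t)
      complete t = s , s≡s , s⊑ t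

  h-solution : FinGen (Π (Es p)) → Projective E (Π (Es p)) → Solution p
  h-solution Π-fg Π-proj = record
    { P      = Π (Es p)
    ; P∈V    = Π-∈V (Es p) E (Es∈V p)
    ; P-fg   = Π-fg
    ; P-proj = Π-proj
    ; g      = h p
    ; f      = idH
    ; f∘g≈h  = λ x k → ≈-refl (Es p k)
    }

  h-solution-least : (Π-fg : FinGen (Π (Es p))) (Π-proj : Projective E (Π (Es p))) →
                     ∀ t → h-solution Π-fg Π-proj ⊑ t
  h-solution-least _ _ t = f t , f∘g≈h t

corollary4p25 : (S : Signature) (E : Equations S) →
    (∀ (m : ℕ) → 1 ≤ m → (Es : Fin m → Algebra S) →
      (∀ k → Es k ∈V E) → (∀ k → OneGen (Es k)) → (∀ k → Exact E (Es k)) →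
      FinGen (Π Es) × Projective E (Π Es)) →
    UnitaryEGenType E
corollary4p25 S E Π-fg-proj p
  with Π-fg , Π-proj ← Π-fg-proj (m p) (m≥1 p) (Es p) (Es∈V p) (Es-1g p) (Es-ex p) =
  least⇒unitary (h-solution Π-fg Π-proj) (h-solution-least Π-fg Π-proj)
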